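{- Let $\mathcal{A}\in\mathfrak{H}$ multiply two $n$-digit integers, let $G^{\mathcal{A}}$ be its CDAG, let $n'\in\mathbb{N}^+$, and let $P_i$ be a Type 1 $n'$-MSP generated by $\mathcal{A}$, with input integers $A_i,B_i$ of size $n_i$. Let $T'_i\subseteq T_i$. Let $\mathcal{Y}_{A_i}\subseteq\mathcal{Y}_i$ (resp. $\mathcal{Y}_{B_i}\subseteq\mathcal{Y}_i$) be a set of vertices each corresponding to a digit of $A_i$ (resp. $B_i$) that is multiplied in at least one of the elementary products in $T'_i$. Then every dominator set $D$ of the vertices corresponding to $T'_i$ with respect to the vertices in $\mathcal{Y}_i$ satisfies $$|D|\ge\max\{|\mathcal{Y}_{A_i}|,|\mathcal{Y}_{B_i}|\}.$$
   Context: Integers are written in base $s\ge2$; $A=(A[n-1],\dots,A[0])_s$. The CDAG of an algorithm has input vertices for input digits, other vertices for results of unit-time operations, and edges for data dependencies. Given a CDAG with input vertex set $I$, a set $D$ is a dominator set for $V'$ with respect to $I'\subseteq I$ if every directed path from a vertex in $I'$ to a vertex in $V'$ contains a vertex of $D$. Standard class: an algorithm multiplying $m$-digit $A,B$ is standard if it directly computes all $m^2$ elementary products $A[i]B[j]$; each $C[i]$ of $C=AB$ is computed by summing the products $A[j]B[k]$ with $j+k=i$ through a summation tree of additions and subtractions only, plus any carry; and internal vertex sets of the summation trees of distinct $C[i]$ are disjoint. Toom-$k$ step ($k\ge2$): split $m$-digit $A,B$ into $k$ blocks of $\lceil m/k\rceil$ digits used as coefficients of degree-$(k-1)$ polynomials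 $p,q$, evaluate at $2k-1$ distinct points, recursively compute the $2k-1$ products (sub-problems), interpolate $r=pq$ with the inverse Vandermonde matrix, recompose $C=\sum_ir_is^{i\lceil m/k\rceil}$. Class $\mathfrak{H}$: algorithms whose instruction function prescribes for each (sub)problem either a standard algorithm or a Toom-$k$ step ($k\ge 2$, possibly varying) with instruction functions for the sub-problems, each sub-problem of a size-$m$ problem having size at most $2m/k<m$. The CDAG of a sub-problem is a sub-CDAG of $G^{\mathcal{A}}$. $n'$-MSPs: the whole problem is an improper sub-problem; if $n\ge n'$, a sub-problem of input size $\ge n'$ all of whose ancestors (sub-problems in the chain of recursive calls generating it) are computed by Toom-Cook steps is a Type 1 $n'$-MSP if computed by a standard algorithm (and a Type 2 one if computed by a Toom-$k$ step whose sub-problems all have size $<n'$). For an $n'$-MSP $P_i$ with inputs $A_i,B_i$ of size $n_i$: $\mathcal{Y}_i$ is the set of input vertices of its sub-CDAG corresponding to the $\lceil n_i/2\rceil$ least significant digits of $A_i$ and of $B_i$. For a Type 1 MSP, $T_i$ is the set of elementary products $A_i[j]B_i[k]$ with $0\le j,k\le (n_i-1)/2$ and $n_i/4\le j+k\le 3n_i/4$ (these are variables of the CDAG). -}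

module Defs where

open import Level using (0ℓ)
open import Data.Nat using (ℕ; _+_; _*_; _≤_; _<_)
open import Data.Fin using (Fin; toℕ)
open import Data.Fin.Subset using (Subset; _∈_)
open import Data.Product using (Σ; ∃; _×_)
open import Data.Sum using (_⊎_)
open import Relation.Binary.PropositionalEquality using (_≡_; _≢_)

-- A CDAG on N vertices (vertices = Fin N).  Edge u v : data dependency u → v.
-- Acyclicity is expressed via a topological numbering of the vertices.
record CDAG (N : ℕ) : Set₁ where
  field
    Edge    : Fin N → Fin N → Set
    acyclic : ∀ {u v} → Edge u v → toℕ u < toℕ v

data Path {N : ℕ} (G : CDAG N) : Fin N → Fin N → Set where
  here : ∀ {u} → Path G u u
  step : ∀ {u w v} → CDAG.Edge G u w → Path G w v → Path G u v

data OnPath {N : ℕ} {G : CDAG N} (x : Fin N) : ∀ {u v} → Path G u v → Set where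
  on-here  : OnPath x (here {u = x})
  on-start : ∀ {w v} {e : CDAG.Edge G x w} {p : Path G w v} → OnPath x (step e p)
  on-later : ∀ {u w v} {e : CDAG.Edge G u w} {p : Path G w v} → OnPath x p → OnPath x (step e p)

IsDominator : {N : ℕ} (G : CDAG N) (I' V' : Fin N → Set) (D : Subset N) → Set
IsDominator {N} G I' V' D =
  ∀ {u v} → I' u → V' v → (p : Path G u v) → ∃ λ x → OnPath x p × x ∈ D

-- The part of G^A belonging to a Type 1 n'-MSP P_i (computed by a standard algorithm),
-- with input integers A_i, B_i of n digits: the vertices of the digits A_i[j], B_i[k]
-- (inputs of the sub-CDAG) and the vertices of the elementary products A_i[j] B_i[k],
-- each computed directly (one unit-time operation) from A_i[j] and B_i[k].
record StandardMSP {N : ℕ} (G : CDAG N) (n : ℕ) : Set where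
  field
    digitA  : Fin n → Fin N
    digitB  : Fin n → Fin N
    prod    : Fin n → Fin n → Fin N
    prod-inj : ∀ {j k j' k'} → prod j k ≡ prod j' k' → (j ≡ j') × (k ≡ k')
    prod≢A  : ∀ j k j' → prod j k ≢ digitA j'
    prod≢B  : ∀ j k k' → prod j k ≢ digitB k'
    edgeA   : ∀ j k → CDAG.Edge G (digitA j) (prod j k)
    edgeB   : ∀ j k → CDAG.Edge G (digitB k) (prod j k)

module _ {N n : ℕ} {G : CDAG N} (P : StandardMSP G n) where
  open StandardMSP P

  -- 𝒴_i : vertices of the ⌈n/2⌉ least significant digits of A_i and of B_i
  -- (index j is among them iff j < ⌈n/2⌉ iff 2 j < n).
  InY : Fin N → Set
  InY v = ∃ λ (j : Fin n) → (2 * toℕ j < n) × ((v ≡ digitA j) ⊎ (v ≡ digitB j))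

  -- Membership of the index pair (j,k) in T_i:
  -- 0 ≤ j,k ≤ (n-1)/2 and n/4 ≤ j+k ≤ 3n/4.
  InT : Fin n → Fin n → Set
  InT j k = (2 * toℕ j + 1 ≤ n) × (2 * toℕ k + 1 ≤ n)
          × (n ≤ 4 * (toℕ j + toℕ k)) × (4 * (toℕ j + toℕ k) ≤ 3 * n)

  ProdVertices : (Fin n → Fin n → Set) → Fin N → Set
  ProdVertices T' v = ∃ λ j → ∃ λ k → T' j k × (v ≡ prod j k)

module Submission where

-- Every digit vertex v of A_i in Y_A is the tail of an edge
-- v → A_i[j]B_i[k] whose head is one of the products in T'_i, and v itself lies
-- in 𝒴_i.  That one-edge path must meet D, i.e. D contains v or its product.
-- Distinct digits of A_i own distinct products (the product determines j) and
-- no product is a digit, so these "blockers" are pairwise distinct: we get an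
-- injection Y_A → D, hence |Y_A| ≤ |D|; likewise |Y_B| ≤ |D|.

open import Defs
open import Data.Nat using (ℕ; suc; _≤_; _⊔_; s≤s)
open import Data.Nat.Properties using (≤-reflexive; m≤n⇒m≤1+n; ⊔-lub; module ≤-Reasoning)
open import Data.Fin using (Fin; zero; suc)
open import Data.Fin.Subset using (Subset; _∈_; ∣_∣; _-_; _⊂_; ⁅_⁆; inside; outside)
open import Data.Fin.Subset.Properties
  using (nonempty?; p⊆q⇒∣p∣≤∣q∣; p─⊥≡p; p─q⊆p; x∈p⇒p-x⊂p; x∈p⇒∣p-x∣<∣p∣; x∈p∧x≢y⇒x∈p-y)
open import Data.Fin.Subset.Induction using (Acc; acc; ⊂-wellFounded)
open import Data.Vec using (_∷_; there)
open import Data.Product using (∃; _×_; _,_; proj₁; proj₂)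
open import Data.Sum using (_⊎_; inj₁; inj₂)
open import Data.Empty using (⊥-elim)
open import Function using (flip)
open import Relation.Nullary using (yes; no)
open import Relation.Binary.PropositionalEquality using (_≡_; _≢_; refl; sym; trans; cong; subst)

∣p∣≤1+∣p-x∣ : ∀ {N} (p : Subset N) (x : Fin N) → ∣ p ∣ ≤ suc ∣ p - x ∣
∣p∣≤1+∣p-x∣ (inside  ∷ p) zero    = s≤s (≤-reflexive (sym (cong ∣_∣ (p─⊥≡p p))))
∣p∣≤1+∣p-x∣ (outside ∷ p) zero    = m≤n⇒m≤1+n (≤-reflexive (sym (cong ∣_∣ (p─⊥≡p p))))
∣p∣≤1+∣p-x∣ (inside  ∷ p) (suc x) = s≤s (∣p∣≤1+∣p-x∣ p x)
∣p∣≤1+∣p-x∣ (outside ∷ p) (suc x) = ∣p∣≤1+∣p-x∣ p x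

x∈p-y⇒x≢y : ∀ {N} {p : Subset N} {x y : Fin N} → x ∈ p - y → x ≢ y
x∈p-y⇒x≢y {p = _ ∷ _} {zero}  {zero}  ()        refl
x∈p-y⇒x≢y {p = _ ∷ p} {suc x} {suc x} (there m) refl = x∈p-y⇒x≢y {p = p} m refl

injection⇒∣A∣≤∣D∣ : ∀ {N} {A : Subset N} → Acc _⊂_ A → (D : Subset N)
  → (f : ∀ {v} → v ∈ A → Fin N)
  → (∀ {v} (p : v ∈ A) → f p ∈ D)
  → (∀ {v w} (p : v ∈ A) (q : w ∈ A) → f p ≡ f q → v ≡ w)
  → ∣ A ∣ ≤ ∣ D ∣
injection⇒∣A∣≤∣D∣ {A = A} (acc smaller) D f f∈D f-inj with nonempty? A
... | no  A-empty = p⊆q⇒∣p∣≤∣q∣ {q = D} (λ v∈A → ⊥-elim (A-empty (_ , v∈A)))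
... | yes (x , x∈A) = begin
    ∣ A ∣                 ≤⟨ ∣p∣≤1+∣p-x∣ A x ⟩
    suc ∣ A - x ∣         ≤⟨ s≤s rest ⟩
    suc ∣ D - f x∈A ∣     ≤⟨ x∈p⇒∣p-x∣<∣p∣ (f∈D x∈A) ⟩
    ∣ D ∣                 ∎
  where
  open ≤-Reasoning
  shrink : ∀ {v} → v ∈ A - x → v ∈ A
  shrink = p─q⊆p A ⁅ x ⁆
  image∈D-fx : ∀ {v} (p : v ∈ A - x) → f (shrink p) ∈ D - f x∈A
  image∈D-fx p = x∈p∧x≢y⇒x∈p-y (f∈D (shrink p))
                   (λ eq → x∈p-y⇒x≢y {p = A} p (f-inj (shrink p) x∈A eq))
  rest : ∣ A - x ∣ ≤ ∣ D - f x∈A ∣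
  rest = injection⇒∣A∣≤∣D∣ (smaller (x∈p⇒p-x⊂p x∈A)) (D - f x∈A)
           (λ p → f (shrink p)) image∈D-fx (λ p q → f-inj (shrink p) (shrink q))

on-single-edge : ∀ {N} {G : CDAG N} {u v x : Fin N} (e : CDAG.Edge G u v)
  → OnPath x (step {G = G} e here) → (x ≡ u) ⊎ (x ≡ v)
on-single-edge e on-start           = inj₁ refl
on-single-edge e (on-later on-here) = inj₂ refl

-- A matching of the vertex set A into V' with respect to I': every v ∈ A
-- lies in I' and has an edge to a partner in V'; the partners are pairwise
-- distinct and lie outside A, so the edges are pairwise vertex-disjoint.
record EdgeMatching {N : ℕ} (G : CDAG N) (I' V' : Fin N → Set) (A : Subset N) : Set where
  field
    partner     : ∀ {v} → v ∈ A → Fin N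
    edge        : ∀ {v} (p : v ∈ A) → CDAG.Edge G v (partner p)
    source      : ∀ {v} → v ∈ A → I' v
    target      : ∀ {v} (p : v ∈ A) → V' (partner p)
    partner∉A   : ∀ {v w} (p : v ∈ A) → w ∈ A → partner p ≢ w
    partner-inj : ∀ {v w} (p : v ∈ A) (q : w ∈ A) → partner p ≡ partner q → v ≡ w

-- Matching bound: each matching edge is an I'-to-V' path and must contain a
-- vertex of the dominator; the chosen vertices are distinct because the edges
-- are disjoint, so a dominator is at least as large as the matched set.
matching⇒dominator-bound : ∀ {N} {G : CDAG N} {I' V' : Fin N → Set} {A : Subset N}
  → EdgeMatching G I' V' A → (D : Subset N) → IsDominator G I' V' D → ∣ A ∣ ≤ ∣ D ∣
matching⇒dominator-bound {A = A} M D dom =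
  injection⇒∣A∣≤∣D∣ (⊂-wellFounded A) D blocker (λ p → proj₂ (proj₂ (blocked p))) blocker-inj
  where
  open EdgeMatching M
  blocked : ∀ {v} (p : v ∈ A) → ∃ λ x → OnPath x (step (edge p) here) × x ∈ D
  blocked p = dom (source p) (target p) (step (edge p) here)
  blocker : ∀ {v} → v ∈ A → Fin _
  blocker p = proj₁ (blocked p)
  blocker-is-endpoint : ∀ {v} (p : v ∈ A) → (blocker p ≡ v) ⊎ (blocker p ≡ partner p)
  blocker-is-endpoint p = on-single-edge (edge p) (proj₁ (proj₂ (blocked p)))
  blocker-inj : ∀ {v w} (p : v ∈ A) (q : w ∈ A) → blocker p ≡ blocker q → v ≡ w
  blocker-inj p q eq with blocker-is-endpoint p | blocker-is-endpoint q
  ... | inj₁ a | inj₁ b = trans (sym a) (trans eq b)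
  ... | inj₁ a | inj₂ b = ⊥-elim (partner∉A q p (trans (sym b) (trans (sym eq) a)))
  ... | inj₂ a | inj₁ b = ⊥-elim (partner∉A p q (trans (sym a) (trans eq b)))
  ... | inj₂ a | inj₂ b = partner-inj p q (trans (sym a) (trans eq b))

digits⇒matching : ∀ {N n} {G : CDAG N} (digit : Fin n → Fin N) (mult : Fin n → Fin n → Fin N)
  → (∀ j k → CDAG.Edge G (digit j) (mult j k))
  → (∀ j k j' → mult j k ≢ digit j')
  → (∀ {j k j' k'} → mult j k ≡ mult j' k' → j ≡ j')
  → (I' V' : Fin N → Set) (R : Fin n → Fin n → Set) → (∀ j k → R j k → V' (mult j k))
  → (Y : Subset N) → (∀ v → v ∈ Y → ∃ λ j → (v ≡ digit j) × I' v × ∃ (R j))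
  → EdgeMatching G I' V' Y
digits⇒matching {G = G} digit mult edge mult≢digit mult-injˡ I' V' R R⇒V' Y Y-digits = record
  { partner     = λ p → mult (row p) (column p)
  ; edge        = λ p → subst (λ u → CDAG.Edge G u (mult (row p) (column p))) (sym (is-digit p)) (edge (row p) (column p))
  ; source      = λ p → proj₁ (proj₂ (proj₂ (Y-digits _ p)))
  ; target      = λ p → R⇒V' (row p) (column p) (proj₂ (proj₂ (proj₂ (proj₂ (Y-digits _ p)))))
  ; partner∉A   = λ p q eq → mult≢digit (row p) (column p) (row q) (trans eq (is-digit q))
  ; partner-inj = λ p q eq →
      trans (is-digit p) (trans (cong digit (mult-injˡ eq)) (sym (is-digit q)))
  }
  where
  row : ∀ {v} → v ∈ Y → Fin _
  row p = proj₁ (Y-digits _ p)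
  is-digit : ∀ {v} (p : v ∈ Y) → v ≡ digit (row p)
  is-digit p = proj₁ (proj₂ (Y-digits _ p))
  column : ∀ {v} → v ∈ Y → Fin _
  column p = proj₁ (proj₂ (proj₂ (proj₂ (Y-digits _ p))))

lemma4 : (N : ℕ) (G : CDAG N) (n' nᵢ : ℕ) → 1 ≤ n' → n' ≤ nᵢ
    → (P : StandardMSP G nᵢ)
    → (T' : Fin nᵢ → Fin nᵢ → Set)
    → (∀ j k → T' j k → InT P j k)
    → (YA YB : Subset N)
    → (∀ v → v ∈ YA → ∃ λ j → (v ≡ StandardMSP.digitA P j) × InY P v × (∃ λ k → T' j k))
    → (∀ v → v ∈ YB → ∃ λ k → (v ≡ StandardMSP.digitB P k) × InY P v × (∃ λ j → T' j k))
    → (D : Subset N)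
    → IsDominator G (InY P) (ProdVertices P T') D
    → ∣ YA ∣ ⊔ ∣ YB ∣ ≤ ∣ D ∣
lemma4 _ G _ _ _ _ P T' _ YA YB YA-digits YB-digits D dom =
  ⊔-lub (matching⇒dominator-bound YA-matched D dom) (matching⇒dominator-bound YB-matched D dom)
  where
  open StandardMSP P
  YA-matched : EdgeMatching G (InY P) (ProdVertices P T') YA
  YA-matched = digits⇒matching digitA prod edgeA prod≢A (λ eq → proj₁ (prod-inj eq))
    (InY P) (ProdVertices P T') T' (λ j k t → j , k , t , refl) YA YA-digits
  YB-matched : EdgeMatching G (InY P) (ProdVertices P T') YB
  YB-matched = digits⇒matching digitB (flip prod) (flip edgeB) (λ k j → prod≢B j k)
    (λ eq → proj₂ (prod-inj eq))
    (InY P) (ProdVertices P T') (flip T') (λ k j t → j , k , t , refl) YB YB-digits
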